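{- Let $S_1,S_2\subseteq\mathbb{F}_2^n\oplus1=\{(x,1):x\in\mathbb{F}_2^n\}\subseteq\mathbb{F}_2^{n+1}$ be ordered Sidon sets of the same size $s$, each of full rank (i.e. $H_{S_i}$ has rank $n+1$). Let $A$ be an $(n+1)\times(n+1)$ matrix over $\mathbb{F}_2$ and $\sigma$ a permutation of $\{1,\dots,s\}$. (i) $A$ is an isomorphism $S_1\to S_2$ if and only if there is a permutation $\sigma$ of $\{1,\dots,s\}$ with $H_{S_1}A=P_\sigma H_{S_2}$; in that case the left multiplication by $P_\sigma^\top$ maps $\mathcal{U}_{S_1}$ onto $\mathcal{U}_{S_2}$. (ii) There is an isomorphism $B:S_1\to S_2$ with $H_{S_1}B=P_\sigma H_{S_2}$ if and only if left multiplication by $P_\sigma^\top$ maps $\mathcal{U}_{S_1}$ to $\mathcal{U}_{S_2}$.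
   Context: A subset $S$ of an abelian group is a Sidon set if for any $x,y,z,w\in S$ of which at least three are distinct, $x+y\neq z+w$. An ordered Sidon set $S$ is a list $S[1],\dots,S[s]$ of its elements (row vectors of length $n+1$ with last coordinate $1$); $H_S$ is the $s\times(n+1)$ matrix whose $i$th row is $S[i]$, and $\mathcal{U}_S$ is the column space of $H_S$, a subspace of the space of column vectors $\mathbb{F}_2^{s}$. $P_\sigma$ denotes the $s\times s$ permutation matrix of $\sigma$. An isomorphism $S_1\to S_2$ is an $(n+1)\times(n+1)$ matrix of the form $\begin{bmatrix}M&0\\ b&1\end{bmatrix}$ with $M$ an invertible $n\times n$ matrix and $b$ a row vector in $\mathbb{F}_2^n$ (this represents the invertible affine map $x\mapsto xM+b$ of $\mathbb{F}_2^n$ acting on rows $(x,1)$), such that right multiplication by it maps the set $S_1$ onto the set $S_2$. -}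

module Defs where

open import Data.Bool using (Bool; true; false; _xor_; _∧_; if_then_else_)
open import Data.Fin using (Fin; zero; suc; fromℕ; inject₁; _≟_)
open import Data.Nat using (ℕ; suc)
open import Data.Product using (Σ; _×_; _,_; ∃)
open import Data.Sum using (_⊎_)
open import Relation.Binary.PropositionalEquality using (_≡_)
open import Relation.Nullary using (¬_; does)
open import Data.Fin.Permutation using (Permutation′; _⟨$⟩ʳ_)

-- F₂ is Bool with xor as addition and ∧ as multiplication.
-- Vectors over F₂ of length k: functions Fin k → Bool, compared pointwise.
Vec₂ : ℕ → Set
Vec₂ k = Fin k → Bool

Mat : ℕ → ℕ → Set
Mat m k = Fin m → Fin k → Bool

_≈v_ : ∀ {k} → Vec₂ k → Vec₂ k → Set
u ≈v v = ∀ i → u i ≡ v i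

_≈m_ : ∀ {m k} → Mat m k → Mat m k → Set
A ≈m B = ∀ i j → A i j ≡ B i j

sum₂ : ∀ {k} → (Fin k → Bool) → Bool
sum₂ {ℕ.zero} f = false
sum₂ {suc k} f = f zero xor sum₂ (λ i → f (suc i))

_⊕_ : ∀ {k} → Vec₂ k → Vec₂ k → Vec₂ k
(u ⊕ v) i = u i xor v i

_·_ : ∀ {m k l} → Mat m k → Mat k l → Mat m l
(A · B) i j = sum₂ (λ t → A i t ∧ B t j)

_·ᶜ_ : ∀ {m k} → Mat m k → Vec₂ k → Vec₂ m
(A ·ᶜ v) i = sum₂ (λ t → A i t ∧ v t)

_ʳ·_ : ∀ {k l} → Vec₂ k → Mat k l → Vec₂ l
(x ʳ· A) j = sum₂ (λ t → x t ∧ A t j)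

transpose : ∀ {m k} → Mat m k → Mat k m
transpose A i j = A j i

identity : ∀ {m} → Mat m m
identity i j = does (i ≟ j)

Invertible : ∀ {m} → Mat m m → Set
Invertible {m} M = Σ (Mat m m) λ N → ((M · N) ≈m identity) × ((N · M) ≈m identity)

AtLeast3Distinct : ∀ {k} → Vec₂ k → Vec₂ k → Vec₂ k → Vec₂ k → Set
AtLeast3Distinct x y z w =
    (¬ x ≈v y × ¬ x ≈v z × ¬ y ≈v z)
  ⊎ (¬ x ≈v y × ¬ x ≈v w × ¬ y ≈v w)
  ⊎ (¬ x ≈v z × ¬ x ≈v w × ¬ z ≈v w)
  ⊎ (¬ y ≈v z × ¬ y ≈v w × ¬ z ≈v w)

-- An ordered set of size s: a list S[1..s] of pairwise distinct vectors.
OrderedSet : ∀ {s k} → (Fin s → Vec₂ k) → Set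
OrderedSet {s} S = ∀ (i j : Fin s) → S i ≈v S j → i ≡ j

IsSidon : ∀ {s k} → (Fin s → Vec₂ k) → Set
IsSidon S = ∀ i j k l → AtLeast3Distinct (S i) (S j) (S k) (S l) →
            ¬ ((S i ⊕ S j) ≈v (S k ⊕ S l))

OrderedSidon : ∀ {s k} → (Fin s → Vec₂ k) → Set
OrderedSidon S = OrderedSet S × IsSidon S

-- Elements lie in F₂ⁿ ⊕ 1: last coordinate equals 1.
InAffine : ∀ {s n} → (Fin s → Vec₂ (suc n)) → Set
InAffine {n = n} S = ∀ i → S i (fromℕ n) ≡ true

H : ∀ {s k} → (Fin s → Vec₂ k) → Mat s k
H S i j = S i j

-- Rank of an s × k matrix equals k (full column rank): the k columns are
-- linearly independent.
FullColumnRank : ∀ {m k} → Mat m k → Set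
FullColumnRank {m} {k} A = ∀ (v : Vec₂ k) → (A ·ᶜ v) ≈v (λ _ → false) → v ≈v (λ _ → false)

_∈U_ : ∀ {s k} → Vec₂ s → (Fin s → Vec₂ k) → Set
_∈U_ {k = k} u S = Σ (Vec₂ k) λ v → (H S ·ᶜ v) ≈v u

MapsOnto : ∀ {s k} → Mat s s → (Fin s → Vec₂ k) → (Fin s → Vec₂ k) → Set
MapsOnto P S₁ S₂ =
    (∀ u → u ∈U S₁ → (P ·ᶜ u) ∈U S₂)
  × (∀ w → w ∈U S₂ → Σ _ λ u → u ∈U S₁ × (P ·ᶜ u) ≈v w)

-- Permutation matrix of σ: (P_σ)_{ij} = 1 iff j = σ(i), so (P_σ H)_i = H_{σ(i)}.
Perm : ℕ → Set
Perm s = Permutation′ s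

P : ∀ {s} → Perm s → Mat s s
P σ i j = does (j ≟ (σ ⟨$⟩ʳ i))

-- Isomorphism S₁ → S₂: A = [[M, 0], [b, 1]] with M invertible (n×n),
-- and x ↦ x A maps the set {S₁[i]} onto the set {S₂[j]}.
IsIso : ∀ {s n} → Mat (suc n) (suc n) → (Fin s → Vec₂ (suc n)) → (Fin s → Vec₂ (suc n)) → Set
IsIso {s} {n} A S₁ S₂ =
    (∀ i → A i (fromℕ n) ≡ does (i ≟ fromℕ n))
  × Invertible (λ (i j : Fin n) → A (inject₁ i) (inject₁ j))
  × (∀ i → Σ (Fin s) λ j → (S₁ i ʳ· A) ≈v S₂ j)
  × (∀ j → Σ (Fin s) λ i → (S₁ i ʳ· A) ≈v S₂ j)

{-# OPTIONS --safe #-}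
-- Write H₁ = H S₁ and H₂ = H S₂. Row i of H₁ A is S₁[i] A, so H₁ A = P_σ H₂ says precisely that
-- x ↦ x A sends S₁[i] to S₂[σ i]; conversely an isomorphism matches the rows in both directions, and
-- since the S₂[j] are distinct the matching is a permutation. From H₁ A = P_σ H₂ we get
-- P_σᵀ H₁ (A v) = H₂ v for every v. Full rank of H₂ then makes A injective, hence invertible by the
-- pigeonhole principle on the finite space F₂ⁿ⁺¹; since every row of H₁ and of H₂ ends in 1, full rank
-- of H₁ forces the last column of A to be the last unit vector, so A = [[M, 0], [b, 1]] with M
-- invertible. The same identity, A being onto, gives P_σᵀ U₁ = U₂. Conversely, if P_σᵀ maps U₁ onto
-- U₂, writing each column of H₂ as P_σᵀ H₁ bⱼ yields B = (bⱼ) with H₁ B = P_σ H₂.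

module Submission where

open import Defs
open import Algebra.Bundles using (CommutativeRing)
open import Data.Bool using (Bool; true; false; _xor_; _∧_)
open import Data.Bool.Properties
  using (xor-∧-commutativeRing; xor-identityʳ; xor-same; ∧-comm; ∧-assoc; ∧-zeroʳ; ∧-distribˡ-xor)
open import Data.Fin using (Fin; zero; suc; fromℕ; inject₁; _≟_; punchOut; combine; finToFun; funToFin)
open import Data.Fin.Properties
  using ( any?; <⇒notInjective; punchOut-injective; finToFun-funToFin; funToFin-finToFin
        ; fromℕ≢inject₁; inject₁-injective; 2↔Bool)
open import Data.Fin.Permutation using (_⟨$⟩ʳ_; _⟨$⟩ˡ_; permutation; inverseˡ; inverseʳ)
open import Data.Nat using (ℕ; zero; suc; _^_)
open import Data.Nat.Properties using (n<1+n)
open import Data.Product using (Σ; _×_; _,_; proj₁; proj₂)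
open import Function.Base using (_∘_)
open import Function.Bundles using (_⇔_; mk⇔; Inverse)
open import Function.Definitions using (Injective; StrictlyInverseˡ; StrictlyInverseʳ)
open import Relation.Binary.PropositionalEquality
  using (_≡_; _≢_; _≗_; refl; sym; trans; cong; cong₂; module ≡-Reasoning)
open import Relation.Nullary using (does; yes; no; contradiction)
open import Relation.Nullary.Decidable using (dec-false; does-⇔)

private
  module F₂ = CommutativeRing xor-∧-commutativeRing

open import Algebra.Properties.Semiring.Sum F₂.semiring
  using (sum; sum-cong-≗; sum-replicate-zero; sum-init-last; ∑-distrib-+; ∑-comm; *-distribˡ-sum; *-distribʳ-sum)
open import Algebra.Properties.Group F₂.+-group using (x∙y⁻¹≈ε⇒x≈y)

open ≡-Reasoning

sum₂≡sum : ∀ {k} (f : Fin k → Bool) → sum₂ f ≡ sum f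
sum₂≡sum {zero}  f = refl
sum₂≡sum {suc k} f = cong (f zero xor_) (sum₂≡sum (f ∘ suc))

sum₂-cong : ∀ {k} {f g : Fin k → Bool} → f ≗ g → sum₂ f ≡ sum₂ g
sum₂-cong {f = f} {g} f≗g = begin
  sum₂ f  ≡⟨ sum₂≡sum f ⟩
  sum f   ≡⟨ sum-cong-≗ f≗g ⟩
  sum g   ≡⟨ sum₂≡sum g ⟨
  sum₂ g  ∎

sum₂-zero : ∀ k → sum₂ {k} (λ _ → false) ≡ false
sum₂-zero k = trans (sum₂≡sum {k} (λ _ → false)) (sum-replicate-zero k)

sum₂-xor : ∀ {k} (f g : Fin k → Bool) → sum₂ (λ t → f t xor g t) ≡ sum₂ f xor sum₂ g
sum₂-xor f g = begin
  sum₂ (λ t → f t xor g t)  ≡⟨ sum₂≡sum (λ t → f t xor g t) ⟩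
  sum (λ t → f t xor g t)   ≡⟨ ∑-distrib-+ f g ⟩
  sum f xor sum g           ≡⟨ cong₂ _xor_ (sum₂≡sum f) (sum₂≡sum g) ⟨
  sum₂ f xor sum₂ g         ∎

∧-distribˡ-sum₂ : ∀ {k} b (f : Fin k → Bool) → b ∧ sum₂ f ≡ sum₂ (λ t → b ∧ f t)
∧-distribˡ-sum₂ b f = begin
  b ∧ sum₂ f            ≡⟨ cong (b ∧_) (sum₂≡sum f) ⟩
  b ∧ sum f             ≡⟨ *-distribˡ-sum b f ⟩
  sum (λ t → b ∧ f t)   ≡⟨ sum₂≡sum (λ t → b ∧ f t) ⟨
  sum₂ (λ t → b ∧ f t)  ∎

∧-distribʳ-sum₂ : ∀ {k} b (f : Fin k → Bool) → sum₂ f ∧ b ≡ sum₂ (λ t → f t ∧ b)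
∧-distribʳ-sum₂ b f = begin
  sum₂ f ∧ b            ≡⟨ cong (_∧ b) (sum₂≡sum f) ⟩
  sum f ∧ b             ≡⟨ *-distribʳ-sum b f ⟩
  sum (λ t → f t ∧ b)   ≡⟨ sum₂≡sum (λ t → f t ∧ b) ⟨
  sum₂ (λ t → f t ∧ b)  ∎

sum₂-comm : ∀ {k l} (f : Fin k → Fin l → Bool) →
            sum₂ (λ i → sum₂ (f i)) ≡ sum₂ (λ j → sum₂ (λ i → f i j))
sum₂-comm f = begin
  sum₂ (λ i → sum₂ (f i))          ≡⟨ sum₂-cong (λ i → sum₂≡sum (f i)) ⟩
  sum₂ (λ i → sum (f i))           ≡⟨ sum₂≡sum (λ i → sum (f i)) ⟩
  sum (λ i → sum (f i))            ≡⟨ ∑-comm f ⟩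
  sum (λ j → sum (λ i → f i j))    ≡⟨ sum₂≡sum (λ j → sum (λ i → f i j)) ⟨
  sum₂ (λ j → sum (λ i → f i j))   ≡⟨ sum₂-cong (λ j → sum₂≡sum (λ i → f i j)) ⟨
  sum₂ (λ j → sum₂ (λ i → f i j))  ∎

sum₂-init-last : ∀ {n} (f : Fin (suc n) → Bool) → sum₂ f ≡ sum₂ (f ∘ inject₁) xor f (fromℕ n)
sum₂-init-last f = begin
  sum₂ f                            ≡⟨ sum₂≡sum f ⟩
  sum f                             ≡⟨ sum-init-last f ⟩
  sum (f ∘ inject₁) xor f (fromℕ _)   ≡⟨ cong (_xor f (fromℕ _)) (sum₂≡sum (f ∘ inject₁)) ⟨
  sum₂ (f ∘ inject₁) xor f (fromℕ _)  ∎

-- The off-diagonal terms vanish definitionally, as suc t ≟ zero and zero ≟ suc j compute to no.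
sum₂-δ : ∀ {k} (j : Fin k) (f : Fin k → Bool) → sum₂ (λ t → does (t ≟ j) ∧ f t) ≡ f j
sum₂-δ {suc k} zero    f = trans (cong (f zero xor_) (sum₂-zero k)) (xor-identityʳ (f zero))
sum₂-δ {suc k} (suc j) f = sum₂-δ j (f ∘ suc)

does-≟-sym : ∀ {k} (i j : Fin k) → does (i ≟ j) ≡ does (j ≟ i)
does-≟-sym i j = does-⇔ (mk⇔ sym sym) (i ≟ j) (j ≟ i)

·ᶜ-cong : ∀ {m k} (A : Mat m k) {u v : Vec₂ k} → u ≈v v → (A ·ᶜ u) ≈v (A ·ᶜ v)
·ᶜ-cong A u≈v i = sum₂-cong (λ t → cong (A i t ∧_) (u≈v t))

·ᶜ-congˡ : ∀ {m k} {A B : Mat m k} (v : Vec₂ k) → A ≈m B → (A ·ᶜ v) ≈v (B ·ᶜ v)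
·ᶜ-congˡ v A≈B i = sum₂-cong (λ t → cong (_∧ v t) (A≈B i t))

·ᶜ-⊕ : ∀ {m k} (A : Mat m k) (u v : Vec₂ k) → (A ·ᶜ (u ⊕ v)) ≈v ((A ·ᶜ u) ⊕ (A ·ᶜ v))
·ᶜ-⊕ A u v i = trans (sum₂-cong (λ t → ∧-distribˡ-xor (A i t) (u t) (v t)))
                     (sum₂-xor (λ t → A i t ∧ u t) (λ t → A i t ∧ v t))

·ᶜ-zero : ∀ {m k} (A : Mat m k) → (A ·ᶜ (λ _ → false)) ≈v (λ _ → false)
·ᶜ-zero {k = k} A i = trans (sum₂-cong (λ t → ∧-zeroʳ (A i t))) (sum₂-zero k)

·ᶜ-assoc : ∀ {m k l} (A : Mat m k) (B : Mat k l) (v : Vec₂ l) → ((A · B) ·ᶜ v) ≈v (A ·ᶜ (B ·ᶜ v))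
·ᶜ-assoc A B v i = begin
  sum₂ (λ u → sum₂ (λ t → A i t ∧ B t u) ∧ v u)
    ≡⟨ sum₂-cong (λ u → ∧-distribʳ-sum₂ (v u) (λ t → A i t ∧ B t u)) ⟩
  sum₂ (λ u → sum₂ (λ t → (A i t ∧ B t u) ∧ v u))
    ≡⟨ sum₂-comm (λ u t → (A i t ∧ B t u) ∧ v u) ⟩
  sum₂ (λ t → sum₂ (λ u → (A i t ∧ B t u) ∧ v u))
    ≡⟨ sum₂-cong (λ t → sum₂-cong (λ u → ∧-assoc (A i t) (B t u) (v u))) ⟩
  sum₂ (λ t → sum₂ (λ u → A i t ∧ (B t u ∧ v u)))
    ≡⟨ sum₂-cong (λ t → ∧-distribˡ-sum₂ (A i t) (λ u → B t u ∧ v u)) ⟨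
  sum₂ (λ t → A i t ∧ sum₂ (λ u → B t u ∧ v u))
    ∎

·ᶜ-identityColumn : ∀ {m k} (A : Mat m k) (j : Fin k) → (A ·ᶜ (λ t → identity t j)) ≈v (λ i → A i j)
·ᶜ-identityColumn A j i = trans (sum₂-cong (λ t → ∧-comm (A i t) _)) (sum₂-δ j (A i))

identity-·ᶜ : ∀ {k} (v : Vec₂ k) → (identity ·ᶜ v) ≈v v
identity-·ᶜ v i = trans (sum₂-cong (λ t → cong (_∧ v t) (does-≟-sym i t))) (sum₂-δ i v)

fullColumnRank⇒injective : ∀ {m k} (A : Mat m k) → FullColumnRank A →
                           ∀ {u v} → (A ·ᶜ u) ≈v (A ·ᶜ v) → u ≈v v
-- In the additive group of F₂ every element is its own inverse, so x ∙ y⁻¹ is x xor y.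
fullColumnRank⇒injective A rank {u} {v} Au≈Av = x∙y⁻¹≈ε⇒x≈y _ _ ∘ rank (u ⊕ v) λ i → begin
  (A ·ᶜ (u ⊕ v)) i              ≡⟨ ·ᶜ-⊕ A u v i ⟩
  (A ·ᶜ u) i xor (A ·ᶜ v) i     ≡⟨ cong (_xor (A ·ᶜ v) i) (Au≈Av i) ⟩
  (A ·ᶜ v) i xor (A ·ᶜ v) i     ≡⟨ xor-same ((A ·ᶜ v) i) ⟩
  false                         ∎

-- If y were missed, punching it out of the codomain would inject Fin (suc m) into Fin m.
Fin-injective⇒surjective : ∀ {m} (f : Fin m → Fin m) → Injective _≡_ _≡_ f →
                           ∀ y → Σ (Fin m) λ x → f x ≡ y
Fin-injective⇒surjective {suc m} f f-injective y with any? (λ x → f x ≟ y)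
... | yes hit  = hit
... | no  miss = contradiction (λ {x} {z} → f-injective ∘ punchOut-injective (y≢f x) (y≢f z))
                               (<⇒notInjective {f = punchOut ∘ y≢f} (n<1+n m))
  where
  y≢f : ∀ x → y ≢ f x
  y≢f x y≡fx = miss (x , sym y≡fx)

funToFin-cong : ∀ {m n} {f g : Fin m → Fin n} → f ≗ g → funToFin f ≡ funToFin g
funToFin-cong {zero}  f≗g = refl
funToFin-cong {suc m} f≗g = cong₂ combine (f≗g zero) (funToFin-cong (f≗g ∘ suc))

-- Vec₂ k is enumerated by Fin (2 ^ k), so the pigeonhole principle applies to it.
open Inverse 2↔Bool using (strictlyInverseˡ; strictlyInverseʳ) renaming (to to toBool; from to fromBool)

toIndex : ∀ {k} → Vec₂ k → Fin (2 ^ k)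
toIndex v = funToFin (fromBool ∘ v)

fromIndex : ∀ k → Fin (2 ^ k) → Vec₂ k
fromIndex k i = toBool ∘ finToFun i

toIndex-cong : ∀ {k} {u v : Vec₂ k} → u ≈v v → toIndex u ≡ toIndex v
toIndex-cong u≈v = funToFin-cong (cong fromBool ∘ u≈v)

fromIndex-toIndex : ∀ {k} (v : Vec₂ k) → fromIndex k (toIndex v) ≈v v
fromIndex-toIndex v t = trans (cong toBool (finToFun-funToFin (fromBool ∘ v) t)) (strictlyInverseˡ (v t))

toIndex-fromIndex : ∀ k (i : Fin (2 ^ k)) → toIndex (fromIndex k i) ≡ i
toIndex-fromIndex k i = trans (funToFin-cong {k} (strictlyInverseʳ ∘ finToFun i)) (funToFin-finToFin {k} i)

Vec₂-injective⇒surjective : ∀ {k} (f : Vec₂ k → Vec₂ k) →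
                            (∀ {u v} → f u ≈v f v → u ≈v v) →
                            ∀ w → Σ (Vec₂ k) λ v → f v ≈v w
Vec₂-injective⇒surjective {k} f f-injective w = fromIndex k i , λ t → begin
  f (fromIndex k i) t        ≡⟨ fromIndex-toIndex (f (fromIndex k i)) t ⟨
  fromIndex k (g i) t        ≡⟨ cong (λ j → fromIndex k j t) gi≡w ⟩
  fromIndex k (toIndex w) t  ≡⟨ fromIndex-toIndex w t ⟩
  w t                        ∎
  where
  g : Fin (2 ^ k) → Fin (2 ^ k)
  g = toIndex ∘ f ∘ fromIndex k

  g-injective : Injective _≡_ _≡_ g
  g-injective {i} {j} gi≡gj = begin
    i                        ≡⟨ toIndex-fromIndex k i ⟨
    toIndex (fromIndex k i)  ≡⟨ toIndex-cong (f-injective f-fromIndex-equal) ⟩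
    toIndex (fromIndex k j)  ≡⟨ toIndex-fromIndex k j ⟩
    j                        ∎
    where
    f-fromIndex-equal : f (fromIndex k i) ≈v f (fromIndex k j)
    f-fromIndex-equal t = begin
      f (fromIndex k i) t  ≡⟨ fromIndex-toIndex (f (fromIndex k i)) t ⟨
      fromIndex k (g i) t  ≡⟨ cong (λ l → fromIndex k l t) gi≡gj ⟩
      fromIndex k (g j) t  ≡⟨ fromIndex-toIndex (f (fromIndex k j)) t ⟩
      f (fromIndex k j) t  ∎

  i : Fin (2 ^ k)
  i = proj₁ (Fin-injective⇒surjective g g-injective (toIndex w))

  gi≡w : g i ≡ toIndex w
  gi≡w = proj₂ (Fin-injective⇒surjective g g-injective (toIndex w))

fullColumnRank⇒surjective : ∀ {k} (A : Mat k k) → FullColumnRank A →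
                            ∀ w → Σ (Vec₂ k) λ v → (A ·ᶜ v) ≈v w
fullColumnRank⇒surjective A rank = Vec₂-injective⇒surjective (A ·ᶜ_) (fullColumnRank⇒injective A rank)

fullColumnRank⇒invertible : ∀ {k} (A : Mat k k) → FullColumnRank A → Invertible A
fullColumnRank⇒invertible {k} A rank = N , AN≈I , NA≈I
  where
  N : Mat k k
  N t j = proj₁ (fullColumnRank⇒surjective A rank (λ i → identity i j)) t

  AN≈I : (A · N) ≈m identity
  AN≈I i j = proj₂ (fullColumnRank⇒surjective A rank (λ i → identity i j)) i

  NA≈I : (N · A) ≈m identity
  NA≈I i j = fullColumnRank⇒injective A rank (λ i → begin
    (A ·ᶜ (N ·ᶜ (λ t → A t j))) i         ≡⟨ ·ᶜ-assoc A N (λ t → A t j) i ⟨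
    ((A · N) ·ᶜ (λ t → A t j)) i          ≡⟨ ·ᶜ-congˡ (λ t → A t j) AN≈I i ⟩
    (identity ·ᶜ (λ t → A t j)) i         ≡⟨ identity-·ᶜ (λ t → A t j) i ⟩
    A i j                                 ≡⟨ ·ᶜ-identityColumn A j i ⟨
    (A ·ᶜ (λ t → identity t j)) i         ∎) i

topLeft : ∀ {n} → Mat (suc n) (suc n) → Mat n n
topLeft A i j = A (inject₁ i) (inject₁ j)

LastColumnIsUnit : ∀ {n} → Mat (suc n) (suc n) → Set
LastColumnIsUnit {n} A = ∀ i → A i (fromℕ n) ≡ identity i (fromℕ n)

topLeft-identity : ∀ {n} → topLeft (identity {suc n}) ≈m identity
topLeft-identity i j = does-⇔ (mk⇔ inject₁-injective (cong inject₁)) (inject₁ i ≟ inject₁ j) (i ≟ j)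

lastColumnIsUnit⇒offLast : ∀ {n} (A : Mat (suc n) (suc n)) → LastColumnIsUnit A →
                           ∀ i → A (inject₁ i) (fromℕ n) ≡ false
lastColumnIsUnit⇒offLast A A-last i =
  trans (A-last (inject₁ i)) (dec-false (inject₁ i ≟ fromℕ _) (fromℕ≢inject₁ ∘ sym))

topLeft-· : ∀ {n} (A B : Mat (suc n) (suc n)) → (∀ i → A (inject₁ i) (fromℕ n) ≡ false) →
            (topLeft A · topLeft B) ≈m topLeft (A · B)
topLeft-· {n} A B A-offLast i j = begin
  inner                                    ≡⟨ xor-identityʳ inner ⟨
  inner xor false                          ≡⟨ cong (λ a → inner xor (a ∧ B last (ι j))) (A-offLast i) ⟨
  inner xor (A (ι i) last ∧ B last (ι j))  ≡⟨ sum₂-init-last (λ t → A (ι i) t ∧ B t (ι j)) ⟨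
  (A · B) (ι i) (ι j)                      ∎
  where
  ι = inject₁
  last = fromℕ n
  inner = sum₂ (λ t → A (ι i) (ι t) ∧ B (ι t) (ι j))

lastColumnIsUnit⇒topLeft-invertible : ∀ {n} (A : Mat (suc n) (suc n)) →
                                      LastColumnIsUnit A → Invertible A → Invertible (topLeft A)
lastColumnIsUnit⇒topLeft-invertible {n} A A-last (N , AN≈I , NA≈I) =
    topLeft N
  , (λ i j → trans (topLeft-· A N (lastColumnIsUnit⇒offLast A A-last) i j)
                   (trans (AN≈I _ _) (topLeft-identity i j)))
  , (λ i j → trans (topLeft-· N A (lastColumnIsUnit⇒offLast N N-last) i j)
                   (trans (NA≈I _ _) (topLeft-identity i j)))
  where
  N-last : LastColumnIsUnit N
  N-last i = begin
    N i (fromℕ n)                            ≡⟨ ·ᶜ-identityColumn N (fromℕ n) i ⟨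
    (N ·ᶜ (λ t → identity t (fromℕ n))) i    ≡⟨ ·ᶜ-cong N A-last i ⟨
    (N · A) i (fromℕ n)                      ≡⟨ NA≈I i (fromℕ n) ⟩
    identity i (fromℕ n)                     ∎

rightInverse⇒permutation : ∀ {m} (f g : Fin m → Fin m) → StrictlyInverseˡ _≡_ f g → Perm m
rightInverse⇒permutation f g f∘g≗id = permutation f g f∘g≗id g∘f≗id
  where
  g-injective : Injective _≡_ _≡_ g
  g-injective {a} {b} ga≡gb = trans (sym (f∘g≗id a)) (trans (cong f ga≡gb) (f∘g≗id b))

  g∘f≗id : StrictlyInverseʳ _≡_ f g
  g∘f≗id i with j , gj≡i ← Fin-injective⇒surjective g g-injective i = begin
    g (f i)      ≡⟨ cong (g ∘ f) gj≡i ⟨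
    g (f (g j))  ≡⟨ cong g (f∘g≗id j) ⟩
    g j          ≡⟨ gj≡i ⟩
    i            ∎

P-·ᶜ : ∀ {s} (σ : Perm s) (u : Vec₂ s) i → (P σ ·ᶜ u) i ≡ u (σ ⟨$⟩ʳ i)
P-·ᶜ σ u i = sum₂-δ (σ ⟨$⟩ʳ i) u

Pᵀ-·ᶜ : ∀ {s} (σ : Perm s) (u : Vec₂ s) i → (transpose (P σ) ·ᶜ u) i ≡ u (σ ⟨$⟩ˡ i)
Pᵀ-·ᶜ σ u i = trans (sum₂-cong (λ t → cong (_∧ u t) (i≟σt≡t≟σ⁻¹i t))) (sum₂-δ (σ ⟨$⟩ˡ i) u)
  where
  i≟σt≡t≟σ⁻¹i : ∀ t → does (i ≟ σ ⟨$⟩ʳ t) ≡ does (t ≟ σ ⟨$⟩ˡ i)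
  i≟σt≡t≟σ⁻¹i t =
    does-⇔ (mk⇔ (sym ∘ Inverse.inverseʳ σ) (sym ∘ Inverse.inverseˡ σ)) (i ≟ σ ⟨$⟩ʳ t) (t ≟ σ ⟨$⟩ˡ i)

module _ {s k l} (X : Mat s k) (A : Mat k l) (Y : Mat s l) (σ : Perm s) where

  XA≈PY⇒rows : (X · A) ≈m (P σ · Y) → ∀ i → (X i ʳ· A) ≈v Y (σ ⟨$⟩ʳ i)
  XA≈PY⇒rows XA≈PY i j = trans (XA≈PY i j) (P-·ᶜ σ (λ t → Y t j) i)

  rows⇒XA≈PY : (∀ i → (X i ʳ· A) ≈v Y (σ ⟨$⟩ʳ i)) → (X · A) ≈m (P σ · Y)
  rows⇒XA≈PY rows i j = trans (rows i j) (sym (P-·ᶜ σ (λ t → Y t j) i))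

  XA≈PY⇒PᵀXAv≈Yv : (X · A) ≈m (P σ · Y) →
                   ∀ v → (transpose (P σ) ·ᶜ (X ·ᶜ (A ·ᶜ v))) ≈v (Y ·ᶜ v)
  XA≈PY⇒PᵀXAv≈Yv XA≈PY v i = begin
    (transpose (P σ) ·ᶜ (X ·ᶜ (A ·ᶜ v))) i  ≡⟨ Pᵀ-·ᶜ σ (X ·ᶜ (A ·ᶜ v)) i ⟩
    (X ·ᶜ (A ·ᶜ v)) (σ ⟨$⟩ˡ i)              ≡⟨ ·ᶜ-assoc X A v (σ ⟨$⟩ˡ i) ⟨
    ((X · A) ·ᶜ v) (σ ⟨$⟩ˡ i)               ≡⟨ ·ᶜ-congˡ v XA≈PY (σ ⟨$⟩ˡ i) ⟩
    ((P σ · Y) ·ᶜ v) (σ ⟨$⟩ˡ i)             ≡⟨ ·ᶜ-assoc (P σ) Y v (σ ⟨$⟩ˡ i) ⟩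
    (P σ ·ᶜ (Y ·ᶜ v)) (σ ⟨$⟩ˡ i)            ≡⟨ P-·ᶜ σ (Y ·ᶜ v) (σ ⟨$⟩ˡ i) ⟩
    (Y ·ᶜ v) (σ ⟨$⟩ʳ (σ ⟨$⟩ˡ i))            ≡⟨ cong (Y ·ᶜ v) (inverseʳ σ) ⟩
    (Y ·ᶜ v) i                              ∎

  XA≈PY⇒fullColumnRank : FullColumnRank Y → (X · A) ≈m (P σ · Y) → FullColumnRank A
  XA≈PY⇒fullColumnRank Y-rank XA≈PY v Av≈0 = Y-rank v λ i → begin
    (Y ·ᶜ v) i                              ≡⟨ XA≈PY⇒PᵀXAv≈Yv XA≈PY v i ⟨
    (transpose (P σ) ·ᶜ (X ·ᶜ (A ·ᶜ v))) i  ≡⟨ Pᵀ-·ᶜ σ (X ·ᶜ (A ·ᶜ v)) i ⟩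
    (X ·ᶜ (A ·ᶜ v)) (σ ⟨$⟩ˡ i)              ≡⟨ ·ᶜ-cong X Av≈0 (σ ⟨$⟩ˡ i) ⟩
    (X ·ᶜ (λ _ → false)) (σ ⟨$⟩ˡ i)         ≡⟨ ·ᶜ-zero X (σ ⟨$⟩ˡ i) ⟩
    false                                   ∎

module _ {s n} (S₁ S₂ : Fin s → Vec₂ (suc n)) where

  HA≈PH⇒lastColumnIsUnit : ∀ A (σ : Perm s) → InAffine S₁ → InAffine S₂ → FullColumnRank (H S₁) →
                           (H S₁ · A) ≈m (P σ · H S₂) → LastColumnIsUnit A
  HA≈PH⇒lastColumnIsUnit A σ affine₁ affine₂ rank₁ HA≈PH =
    fullColumnRank⇒injective (H S₁) rank₁ λ i → begin
      (H S₁ · A) i (fromℕ n)                    ≡⟨ XA≈PY⇒rows (H S₁) A (H S₂) σ HA≈PH i (fromℕ n) ⟩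
      S₂ (σ ⟨$⟩ʳ i) (fromℕ n)                   ≡⟨ affine₂ (σ ⟨$⟩ʳ i) ⟩
      true                                      ≡⟨ affine₁ i ⟨
      S₁ i (fromℕ n)                            ≡⟨ ·ᶜ-identityColumn (H S₁) (fromℕ n) i ⟨
      (H S₁ ·ᶜ (λ t → identity t (fromℕ n))) i  ∎

  HA≈PH⇒iso : ∀ A (σ : Perm s) → InAffine S₁ → InAffine S₂ →
              FullColumnRank (H S₁) → FullColumnRank (H S₂) →
              (H S₁ · A) ≈m (P σ · H S₂) → IsIso A S₁ S₂
  HA≈PH⇒iso A σ affine₁ affine₂ rank₁ rank₂ HA≈PH =
      A-last
    , lastColumnIsUnit⇒topLeft-invertible A A-last
        (fullColumnRank⇒invertible A (XA≈PY⇒fullColumnRank (H S₁) A (H S₂) σ rank₂ HA≈PH))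
    , (λ i → σ ⟨$⟩ʳ i , rows i)
    , (λ j → σ ⟨$⟩ˡ j , λ t → trans (rows (σ ⟨$⟩ˡ j) t) (cong (λ i → S₂ i t) (inverseʳ σ)))
    where
    A-last : LastColumnIsUnit A
    A-last = HA≈PH⇒lastColumnIsUnit A σ affine₁ affine₂ rank₁ HA≈PH

    rows : ∀ i → (S₁ i ʳ· A) ≈v S₂ (σ ⟨$⟩ʳ i)
    rows = XA≈PY⇒rows (H S₁) A (H S₂) σ HA≈PH

  iso⇒HA≈PH : ∀ A → OrderedSet S₂ → IsIso A S₁ S₂ → Σ (Perm s) λ σ → (H S₁ · A) ≈m (P σ · H S₂)
  iso⇒HA≈PH A S₂-distinct (_ , _ , forth , back) = σ , rows⇒XA≈PY (H S₁) A (H S₂) σ (proj₂ ∘ forth)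
    where
    f g : Fin s → Fin s
    f = proj₁ ∘ forth
    g = proj₁ ∘ back

    f∘g≗id : StrictlyInverseˡ _≡_ f g
    f∘g≗id j = S₂-distinct (f (g j)) j λ t → trans (sym (proj₂ (forth (g j)) t)) (proj₂ (back j) t)

    σ : Perm s
    σ = rightInverse⇒permutation f g f∘g≗id

module _ {s k} (S₁ S₂ : Fin s → Vec₂ k) (σ : Perm s) where

  HA≈PH⇒mapsOnto : ∀ A → FullColumnRank (H S₂) → (H S₁ · A) ≈m (P σ · H S₂) →
                   MapsOnto (transpose (P σ)) S₁ S₂
  HA≈PH⇒mapsOnto A rank₂ HA≈PH = forth , back
    where
    PᵀHAv≈Hv : ∀ v → (transpose (P σ) ·ᶜ (H S₁ ·ᶜ (A ·ᶜ v))) ≈v (H S₂ ·ᶜ v)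
    PᵀHAv≈Hv = XA≈PY⇒PᵀXAv≈Yv (H S₁) A (H S₂) σ HA≈PH

    A-surjective : ∀ v → Σ (Vec₂ k) λ w → (A ·ᶜ w) ≈v v
    A-surjective = fullColumnRank⇒surjective A (XA≈PY⇒fullColumnRank (H S₁) A (H S₂) σ rank₂ HA≈PH)

    forth : ∀ u → u ∈U S₁ → (transpose (P σ) ·ᶜ u) ∈U S₂
    forth u (v , H₁v≈u) with w , Aw≈v ← A-surjective v = w , λ i → begin
      (H S₂ ·ᶜ w) i                              ≡⟨ PᵀHAv≈Hv w i ⟨
      (transpose (P σ) ·ᶜ (H S₁ ·ᶜ (A ·ᶜ w))) i  ≡⟨ ·ᶜ-cong (transpose (P σ)) H₁Aw≈u i ⟩
      (transpose (P σ) ·ᶜ u) i                   ∎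
      where
      H₁Aw≈u : (H S₁ ·ᶜ (A ·ᶜ w)) ≈v u
      H₁Aw≈u j = trans (·ᶜ-cong (H S₁) Aw≈v j) (H₁v≈u j)

    back : ∀ w → w ∈U S₂ → Σ (Vec₂ s) λ u → u ∈U S₁ × (transpose (P σ) ·ᶜ u) ≈v w
    back w (v , H₂v≈w) = H S₁ ·ᶜ (A ·ᶜ v) , (A ·ᶜ v , λ _ → refl) , λ i → trans (PᵀHAv≈Hv v i) (H₂v≈w i)

  mapsOnto⇒HB≈PH : MapsOnto (transpose (P σ)) S₁ S₂ → Σ (Mat k k) λ B → (H S₁ · B) ≈m (P σ · H S₂)
  mapsOnto⇒HB≈PH (_ , onto) = B , HB≈PH
    where
    column : ∀ j → Σ (Vec₂ k) λ b → (transpose (P σ) ·ᶜ (H S₁ ·ᶜ b)) ≈v (λ i → S₂ i j)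
    column j with onto (λ i → S₂ i j) ((λ t → identity t j) , ·ᶜ-identityColumn (H S₂) j)
    ... | u , (b , H₁b≈u) , Pᵀu≈S₂j = b , λ i → trans (·ᶜ-cong (transpose (P σ)) H₁b≈u i) (Pᵀu≈S₂j i)

    B : Mat k k
    B t j = proj₁ (column j) t

    HB≈PH : (H S₁ · B) ≈m (P σ · H S₂)
    HB≈PH i j = begin
      (H S₁ ·ᶜ b) i                                 ≡⟨ cong (H S₁ ·ᶜ b) (inverseˡ σ) ⟨
      (H S₁ ·ᶜ b) (σ ⟨$⟩ˡ (σ ⟨$⟩ʳ i))               ≡⟨ Pᵀ-·ᶜ σ (H S₁ ·ᶜ b) (σ ⟨$⟩ʳ i) ⟨
      (transpose (P σ) ·ᶜ (H S₁ ·ᶜ b)) (σ ⟨$⟩ʳ i)   ≡⟨ proj₂ (column j) (σ ⟨$⟩ʳ i) ⟩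
      S₂ (σ ⟨$⟩ʳ i) j                               ≡⟨ P-·ᶜ σ (λ t → S₂ t j) i ⟨
      (P σ · H S₂) i j                              ∎
      where
      b = proj₁ (column j)

lemma10 : ∀ {n s : ℕ} (S₁ S₂ : Fin s → Vec₂ (suc n)) →
    OrderedSidon S₁ → OrderedSidon S₂ →
    InAffine S₁ → InAffine S₂ →
    FullColumnRank (H S₁) → FullColumnRank (H S₂) →
    ((A : Mat (suc n) (suc n)) →
        (IsIso A S₁ S₂ ⇔ Σ (Perm s) (λ σ → (H S₁ · A) ≈m (P σ · H S₂)))
      × ((σ : Perm s) → IsIso A S₁ S₂ → (H S₁ · A) ≈m (P σ · H S₂) →
          MapsOnto (transpose (P σ)) S₁ S₂))
    × ((σ : Perm s) →
        (Σ (Mat (suc n) (suc n)) (λ B → IsIso B S₁ S₂ × (H S₁ · B) ≈m (P σ · H S₂)))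
          ⇔ MapsOnto (transpose (P σ)) S₁ S₂)
lemma10 S₁ S₂ _ (S₂-distinct , _) affine₁ affine₂ rank₁ rank₂ =
    (λ A → mk⇔ (iso⇒HA≈PH S₁ S₂ A S₂-distinct) (λ (σ , HA≈PH) → iso A σ HA≈PH)
         , λ σ _ → HA≈PH⇒mapsOnto S₁ S₂ σ A rank₂)
  , λ σ → mk⇔ (λ (B , _ , HB≈PH) → HA≈PH⇒mapsOnto S₁ S₂ σ B rank₂ HB≈PH)
              (λ onto → let B , HB≈PH = mapsOnto⇒HB≈PH S₁ S₂ σ onto in B , iso B σ HB≈PH , HB≈PH)
  where
  iso : ∀ A σ → (H S₁ · A) ≈m (P σ · H S₂) → IsIso A S₁ S₂
  iso A σ = HA≈PH⇒iso S₁ S₂ A σ affine₁ affine₂ rank₁ rank₂
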